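{- Let $\mathfrak a_{n,m}$ be the number of $\sigma\in\mathcal{I}_n(100,120)$ with $\max(\sigma)=m$. Let $\mathfrak b_{n,k}$ be the number of words $\omega\in\mathcal W_{n,k}$ avoiding $120$ such that $\omega_i=\omega_j\neq k-1$ implies $i=j$ (no letter other than $k-1$ is repeated). Then for all integers $0<m<n$, $$\mathfrak a_{n,m}=\sum_{p=m+1}^{n}\sum_{j=0}^{m-1}\mathfrak a_{p-1,j}\,\mathfrak b_{n-p,m-j+1}.$$
   Context: For $n\in\mathbb N$, an inversion sequence of size $n$ is a sequence $\sigma=(\sigma_1,\dots,\sigma_n)\in\mathbb N^n$ with $\sigma_i<i$ for all $i$. An integer sequence contains a pattern $\rho$ (a finite integer sequence such as $100$ or $120$) if it has a subsequence order-isomorphic to $\rho$, and avoids $\rho$ otherwise. $\mathcal{I}_n(P)$ denotes the set of inversion sequences of size $n$ avoiding every pattern in the set $P$. $\mathcal W_{n,k}=\{0,\dots,k-1\}^n$ is the set of words of length $n$ over the alphabet $\{0,\dots,k-1\}$. $\max(\sigma)$ is the largest entry of $\sigma$. -}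

module Defs where

open import Data.Nat using (ℕ; zero; suc; _+_; _∸_; _<_; _≤_; _⊔_)
import Data.Nat as ℕ
open import Data.Fin using (Fin; toℕ)
import Data.Fin as Fin
open import Data.Fin.Properties using (any?; all?)
open import Data.List using (List; []; _∷_; [_]; length; map; concatMap; upTo; filter; lookup; foldr)
open import Data.Nat.ListAction using (sum)
open import Data.Product using (Σ; ∃; _×_; _,_)
open import Relation.Binary.PropositionalEquality using (_≡_; _≢_)
open import Relation.Nullary using (Dec; ¬_)
open import Relation.Nullary.Decidable using (_×-dec_; ¬?; _→-dec_)

words : ℕ → ℕ → List (List ℕ)
words zero    k = [ [] ]
words (suc n) k = concatMap (λ w → map (λ x → x ∷ w) (upTo k)) (words n k)

-- σ is an inversion sequence: σ_i < i for 1-based positions i,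
-- i.e. the entry at 0-based position i is < i+1.
IsInvSeq : List ℕ → Set
IsInvSeq σ = ∀ (i : Fin (length σ)) → lookup σ i < suc (toℕ i)

-- σ contains 100: a subsequence σ_i σ_j σ_k (i<j<k) order-isomorphic to 1 0 0,
-- i.e. σ_i > σ_j = σ_k.
Contains100 : List ℕ → Set
Contains100 σ = Σ (Fin (length σ)) λ i → Σ (Fin (length σ)) λ j → Σ (Fin (length σ)) λ k →
  (i Fin.< j) × (j Fin.< k) × (lookup σ j < lookup σ i) × (lookup σ j ≡ lookup σ k)

Contains120 : List ℕ → Set
Contains120 σ = Σ (Fin (length σ)) λ i → Σ (Fin (length σ)) λ j → Σ (Fin (length σ)) λ k →
  (i Fin.< j) × (j Fin.< k) × (lookup σ k < lookup σ i) × (lookup σ i < lookup σ j)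

-- Largest entry (max of the empty sequence is taken to be 0).
maxEntry : List ℕ → ℕ
maxEntry = foldr _⊔_ 0

NoRepeatExceptLast : ℕ → List ℕ → Set
NoRepeatExceptLast k ω = ∀ (i j : Fin (length ω)) →
  lookup ω i ≡ lookup ω j → lookup ω i ≢ k ∸ 1 → i ≡ j

isInvSeq? : ∀ σ → Dec (IsInvSeq σ)
isInvSeq? σ = all? λ i → lookup σ i ℕ.<? suc (toℕ i)

contains100? : ∀ σ → Dec (Contains100 σ)
contains100? σ = any? λ i → any? λ j → any? λ k →
  (i Fin.<? j) ×-dec (j Fin.<? k) ×-dec (lookup σ j ℕ.<? lookup σ i) ×-dec (lookup σ j ℕ.≟ lookup σ k)

contains120? : ∀ σ → Dec (Contains120 σ)
contains120? σ = any? λ i → any? λ j → any? λ k →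
  (i Fin.<? j) ×-dec (j Fin.<? k) ×-dec (lookup σ k ℕ.<? lookup σ i) ×-dec (lookup σ i ℕ.<? lookup σ j)

noRepeatExceptLast? : ∀ k ω → Dec (NoRepeatExceptLast k ω)
noRepeatExceptLast? k ω = all? λ i → all? λ j →
  (lookup ω i ℕ.≟ lookup ω j) →-dec ((¬? (lookup ω i ℕ.≟ k ∸ 1)) →-dec (i Fin.≟ j))

-- σ ∈ 𝓘_n(100,120) with max σ = m  (σ ranges over 𝒲_{n,n}, which contains all
-- inversion sequences of size n).
IsA : ℕ → List ℕ → Set
IsA m σ = IsInvSeq σ × ¬ Contains100 σ × ¬ Contains120 σ × maxEntry σ ≡ m

isA? : ∀ m σ → Dec (IsA m σ)
isA? m σ = isInvSeq? σ ×-dec ¬? (contains100? σ) ×-dec ¬? (contains120? σ) ×-dec (maxEntry σ ℕ.≟ m)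

𝔞 : ℕ → ℕ → ℕ
𝔞 n m = length (filter (isA? m) (words n n))

IsB : ℕ → List ℕ → Set
IsB k ω = ¬ Contains120 ω × NoRepeatExceptLast k ω

isB? : ∀ k ω → Dec (IsB k ω)
isB? k ω = ¬? (contains120? ω) ×-dec noRepeatExceptLast? k ω

𝔟 : ℕ → ℕ → ℕ
𝔟 n k = length (filter (isB? k) (words n k))

-- Σ_{i=a}^{b} f i  (empty if b < a)
ΣFromTo : ℕ → ℕ → (ℕ → ℕ) → ℕ
ΣFromTo a b f = sum (map (λ t → f (a + t)) (upTo (suc b ∸ a)))

-- Write σ ∈ 𝓘_n(100,120) with max σ = m as σ = a · m · c, where m sits at
-- position p (1-based) of its first occurrence, so m < p since σ is an inversion sequence.
-- Let j = max a < m.  A letter z < j in c would give the 120-occurrence j m z, and a repeated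
-- letter y < m in c would give the 100-occurrence m y y.  Conversely, as both patterns end
-- below their first letter, no occurrence can start in a (letters ≤ j) and end in m · c
-- (letters ≥ j).  Hence σ ↦ (p, j, a, c - j) is a bijection onto the quadruples with
-- a ∈ 𝓘_{p-1}(100,120), max a = j, and c - j a 120-avoiding word over {0,…,m-j} repeating
-- no letter but m - j; the count follows since both sides are duplicate-free lists.

module Submission where

open import Defs
open import Data.Nat using (ℕ; zero; suc; _+_; _∸_; _*_; _<_; _≤_; z≤n; s≤s; z<s; s≤s⁻¹; _≟_)
open import Data.Nat.Properties
open import Data.Fin using (Fin; toℕ) renaming (zero to fzero; suc to fsuc)
import Data.Fin as Fin
import Data.Fin.Properties as Fin
open import Data.List using (List; []; _∷_; length; map; concatMap; upTo; filter; lookup; _++_)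
open import Data.List.Properties using (length-map; length-++; map-++; map-∘; map-cong; ∷-injective)
open import Data.Nat.ListAction using (sum)
open import Data.List.Membership.Propositional using (_∈_; find; lose)
open import Data.List.Membership.Propositional.Properties
  using ( ∈-concatMap⁺; ∈-concatMap⁻; ∈-map⁺; ∈-map⁻; ∈-++⁺ˡ; ∈-++⁺ʳ; ∈-++⁻
        ; ∈-upTo⁺; ∈-upTo⁻; ∈-filter⁺; ∈-filter⁻)
open import Data.List.Membership.Propositional.Properties.WithK using (unique∧set⇒bag)
open import Data.List.Relation.Unary.Any using (here; there)
open import Data.List.Relation.Unary.All as All using (All; []; _∷_)
import Data.List.Relation.Unary.All.Properties as All
open import Data.List.Relation.Unary.AllPairs as AllPairs using (AllPairs; []; _∷_)
import Data.List.Relation.Unary.AllPairs.Properties as AllPairs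
open import Data.List.Relation.Unary.Unique.Propositional using (Unique)
import Data.List.Relation.Unary.Unique.Propositional.Properties as Unique
open import Data.List.Relation.Binary.BagAndSetEquality using (∼bag⇒↭)
open import Data.List.Relation.Binary.Permutation.Propositional.Properties using (↭-length)
open import Data.Product using (Σ; ∃₂; _×_; _,_; proj₁; proj₂; uncurry; map₁)
open import Data.Product.Properties using (,-injective)
open import Data.Sum using (inj₁; inj₂)
open import Function using (_∘_; flip; case_of_; _⇔_; mk⇔; Equivalence)
open import Relation.Nullary using (¬_; yes; no; contradiction)
open import Relation.Binary using (tri<; tri≈; tri>)
open import Relation.Binary.PropositionalEquality

private variable
  A B : Set

-- Pairs and triples of a list

module _ {P : A → Set} where

  All-lookup⁺ : ∀ xs → (∀ i → P (lookup xs i)) → All P xs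
  All-lookup⁺ []       h = []
  All-lookup⁺ (x ∷ xs) h = h fzero ∷ All-lookup⁺ xs (h ∘ fsuc)

  All-lookup⁻ : ∀ {xs} → All P xs → ∀ i → P (lookup xs i)
  All-lookup⁻ (px ∷ _)   fzero    = px
  All-lookup⁻ (_  ∷ pxs) (fsuc i) = All-lookup⁻ pxs i

module _ {R : A → A → Set} where

  AllPairs-lookup⁺ : ∀ xs → (∀ {i j} → i Fin.< j → R (lookup xs i) (lookup xs j)) → AllPairs R xs
  AllPairs-lookup⁺ []       h = []
  AllPairs-lookup⁺ (x ∷ xs) h =
    All-lookup⁺ xs (λ j → h {fzero} {fsuc j} (s≤s z≤n)) ∷ AllPairs-lookup⁺ xs (h ∘ s≤s)

  AllPairs-lookup⁻ : ∀ {xs} → AllPairs R xs → ∀ {i j} → i Fin.< j → R (lookup xs i) (lookup xs j)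
  AllPairs-lookup⁻ (rx ∷ _)   {fzero}  {fsuc j} _       = All-lookup⁻ rx j
  AllPairs-lookup⁻ (_  ∷ rxs) {fsuc i} {fsuc j} (s≤s i<j) = AllPairs-lookup⁻ rxs i<j

  AllPairs-fromAll : ∀ {P : A → Set} {xs} → (∀ {x y} → P x → P y → R x y) → All P xs → AllPairs R xs
  AllPairs-fromAll r []         = []
  AllPairs-fromAll r (px ∷ pxs) = All.map (r px) pxs ∷ AllPairs-fromAll r pxs

  AllPairs-++⁻ : ∀ xs {ys} → AllPairs R (xs ++ ys) →
                 AllPairs R xs × All (λ x → All (R x) ys) xs × AllPairs R ys
  AllPairs-++⁻ []       rys        = [] , [] , rys
  AllPairs-++⁻ (x ∷ xs) (rx ∷ rxs) =
    let rxs′ , cross , rys = AllPairs-++⁻ xs rxs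
    in  (All.++⁻ˡ xs rx ∷ rxs′) , (All.++⁻ʳ xs rx ∷ cross) , rys

data AllTriples (R : A → A → A → Set) : List A → Set where
  []  : AllTriples R []
  _∷_ : ∀ {x xs} → AllPairs (R x) xs → AllTriples R xs → AllTriples R (x ∷ xs)

module _ {R : A → A → A → Set} where

  AllTriples-map : ∀ {S : A → A → A → Set} {xs} → (∀ {x y z} → R x y z → S x y z) →
                   AllTriples R xs → AllTriples S xs
  AllTriples-map f []         = []
  AllTriples-map f (rx ∷ rxs) = AllPairs.map f rx ∷ AllTriples-map f rxs

  AllTriples-lookup⁺ : ∀ xs → (∀ {i j k} → i Fin.< j → j Fin.< k →
                       R (lookup xs i) (lookup xs j) (lookup xs k)) → AllTriples R xs
  AllTriples-lookup⁺ []       h = []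
  AllTriples-lookup⁺ (x ∷ xs) h =
    AllPairs-lookup⁺ xs (λ {j} {k} j<k → h {fzero} {fsuc j} {fsuc k} (s≤s z≤n) (s≤s j<k))
    ∷ AllTriples-lookup⁺ xs (λ i<j j<k → h (s≤s i<j) (s≤s j<k))

  AllTriples-lookup⁻ : ∀ {xs} → AllTriples R xs → ∀ {i j k} → i Fin.< j → j Fin.< k →
                       R (lookup xs i) (lookup xs j) (lookup xs k)
  AllTriples-lookup⁻ (rx ∷ _)   {fzero}  {fsuc j} {fsuc k} _         (s≤s j<k) = AllPairs-lookup⁻ rx j<k
  AllTriples-lookup⁻ (_  ∷ rxs) {fsuc i} {fsuc j} {fsuc k} (s≤s i<j) (s≤s j<k) = AllTriples-lookup⁻ rxs i<j j<k

  AllTriples-map⁺ : {f : B → A} {xs : List B} →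
                    AllTriples (λ x y z → R (f x) (f y) (f z)) xs → AllTriples R (map f xs)
  AllTriples-map⁺ []         = []
  AllTriples-map⁺ (rx ∷ rxs) = AllPairs.map⁺ rx ∷ AllTriples-map⁺ rxs

  AllTriples-map⁻ : {f : B → A} (xs : List B) →
                    AllTriples R (map f xs) → AllTriples (λ x y z → R (f x) (f y) (f z)) xs
  AllTriples-map⁻ []       []         = []
  AllTriples-map⁻ (_ ∷ xs) (rx ∷ rxs) = AllPairs.map⁻ rx ∷ AllTriples-map⁻ xs rxs

  AllTriples-++⁻ : ∀ xs {ys} → AllTriples R (xs ++ ys) →
                   AllTriples R xs × All (λ x → AllPairs (R x) ys) xs × AllTriples R ys
  AllTriples-++⁻ []       rys        = [] , [] , rys
  AllTriples-++⁻ (x ∷ xs) (rx ∷ rxs) =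
    let rxs′ , cross , rys = AllTriples-++⁻ xs rxs
        rx-xs , _ , rx-ys  = AllPairs-++⁻ xs rx
    in  (rx-xs ∷ rxs′) , (rx-ys ∷ cross) , rys

  AllTriples-++⁺-separated : ∀ {P Q : A → Set} {xs ys} → (∀ {x y z} → P x → Q z → R x y z) →
    All P xs → All Q ys → AllTriples R xs → AllTriples R ys → AllTriples R (xs ++ ys)
  AllTriples-++⁺-separated sep []         qys []         rys = rys
  AllTriples-++⁺-separated sep (px ∷ pxs) qys (rx ∷ rxs) rys =
    AllPairs.++⁺ rx (AllPairs-fromAll (λ _ qz → sep px qz) qys) (All.map (λ _ → All.map (sep px) qys) pxs)
    ∷ AllTriples-++⁺-separated sep pxs qys rxs rys

  AllTriples-fromAllPairs : ∀ {P : A → Set} {S : A → A → Set} {xs} → (∀ {x y z} → P x → S y z → R x y z) →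
    All P xs → AllPairs S xs → AllTriples R xs
  AllTriples-fromAllPairs r []         []         = []
  AllTriples-fromAllPairs r (px ∷ pxs) (_ ∷ sxs) =
    AllPairs.map (r px) sxs ∷ AllTriples-fromAllPairs r pxs sxs

-- Counting duplicate-free lists

dependentProduct : List A → (A → List B) → List (A × B)
dependentProduct []       ys = []
dependentProduct (x ∷ xs) ys = map (x ,_) (ys x) ++ dependentProduct xs ys

module _ {ys : A → List B} where

  ∈-dependentProduct⁺ : ∀ {xs x y} → x ∈ xs → y ∈ ys x → (x , y) ∈ dependentProduct xs ys
  ∈-dependentProduct⁺ (here refl)            y∈ = ∈-++⁺ˡ (∈-map⁺ (_ ,_) y∈)
  ∈-dependentProduct⁺ {xs = x ∷ _} (there x∈) y∈ = ∈-++⁺ʳ (map (x ,_) (ys x)) (∈-dependentProduct⁺ x∈ y∈)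

  ∈-dependentProduct⁻ : ∀ xs {x y} → (x , y) ∈ dependentProduct xs ys → x ∈ xs × y ∈ ys x
  ∈-dependentProduct⁻ (x ∷ xs) xy∈ with ∈-++⁻ (map (x ,_) (ys x)) xy∈
  ... | inj₁ xy∈ʰ with ∈-map⁻ (x ,_) xy∈ʰ
  ...   | _ , y∈ , refl = here refl , y∈
  ∈-dependentProduct⁻ (x ∷ xs) xy∈ | inj₂ xy∈ᵗ =
    let x∈ , y∈ = ∈-dependentProduct⁻ xs xy∈ᵗ in there x∈ , y∈

  dependentProduct⁺ : ∀ {xs} → Unique xs → (∀ x → Unique (ys x)) → Unique (dependentProduct xs ys)
  dependentProduct⁺ []           u = []
  dependentProduct⁺ {x ∷ xs} (x∉xs ∷ uxs) u =
    Unique.++⁺ (Unique.map⁺ (proj₂ ∘ ,-injective) (u x)) (dependentProduct⁺ uxs u) disjoint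
    where
    disjoint : ∀ {v} → ¬ (v ∈ map (x ,_) (ys x) × v ∈ dependentProduct xs ys)
    disjoint (v∈ʰ , v∈ᵗ) with ∈-map⁻ (x ,_) v∈ʰ
    ... | _ , _ , refl = All.lookup x∉xs (proj₁ (∈-dependentProduct⁻ xs v∈ᵗ)) refl

  length-dependentProduct : ∀ xs → length (dependentProduct xs ys) ≡ sum (map (length ∘ ys) xs)
  length-dependentProduct []       = refl
  length-dependentProduct (x ∷ xs) = begin
    length (map (x ,_) (ys x) ++ dependentProduct xs ys)
      ≡⟨ length-++ (map (x ,_) (ys x)) ⟩
    length (map (x ,_) (ys x)) + length (dependentProduct xs ys)
      ≡⟨ cong₂ _+_ (length-map (x ,_) (ys x)) (length-dependentProduct xs) ⟩
    length (ys x) + sum (map (length ∘ ys) xs)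
      ∎
    where open ≡-Reasoning

concatMap-map-dependentProduct : ∀ {C : Set} (g : A → B → C) xs {ys : A → List B} →
  concatMap (λ x → map (g x) (ys x)) xs ≡ map (uncurry g) (dependentProduct xs ys)
concatMap-map-dependentProduct g []       = refl
concatMap-map-dependentProduct g (x ∷ xs) {ys} = begin
  map (g x) (ys x) ++ concatMap (λ x → map (g x) (ys x)) xs
    ≡⟨ cong₂ _++_ (map-∘ (ys x)) (concatMap-map-dependentProduct g xs) ⟩
  map (uncurry g) (map (x ,_) (ys x)) ++ map (uncurry g) (dependentProduct xs ys)
    ≡⟨ map-++ (uncurry g) (map (x ,_) (ys x)) (dependentProduct xs ys) ⟨
  map (uncurry g) (map (x ,_) (ys x) ++ dependentProduct xs ys)
    ∎
  where open ≡-Reasoning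

sum-map-const : ∀ (xs : List A) c → sum (map (λ _ → c) xs) ≡ length xs * c
sum-map-const []       c = refl
sum-map-const (x ∷ xs) c = cong (c +_) (sum-map-const xs c)

map⁺-injectiveOn : ∀ {f : A → B} {xs} → (∀ {x y} → x ∈ xs → y ∈ xs → f x ≡ f y → x ≡ y) →
                   Unique xs → Unique (map f xs)
map⁺-injectiveOn inj []           = []
map⁺-injectiveOn inj (x∉xs ∷ uxs) =
  All.map⁺ (All.tabulate (λ y∈ fx≡fy → All.lookup x∉xs y∈ (inj (here refl) (there y∈) fx≡fy)))
  ∷ map⁺-injectiveOn (λ x∈ y∈ → inj (there x∈) (there y∈)) uxs

length-≡-bijection : ∀ {xs : List A} {ys : List B} (f : A → B) (g : B → A) → Unique xs → Unique ys →
  (∀ {x} → x ∈ xs → f x ∈ ys × g (f x) ≡ x) → (∀ {y} → y ∈ ys → g y ∈ xs × f (g y) ≡ y) →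
  length xs ≡ length ys
length-≡-bijection {xs = xs} {ys} f g uxs uys f-section g-section = begin
  length xs          ≡⟨ length-map f xs ⟨
  length (map f xs)  ≡⟨ ↭-length (∼bag⇒↭ (unique∧set⇒bag ufxs uys (mk⇔ to from))) ⟩
  length ys          ∎
  where
  open ≡-Reasoning
  gf : ∀ {x} → x ∈ xs → g (f x) ≡ x
  gf = proj₂ ∘ f-section
  ufxs : Unique (map f xs)
  ufxs = map⁺-injectiveOn (λ x∈ y∈ fx≡fy → trans (sym (gf x∈)) (trans (cong g fx≡fy) (gf y∈))) uxs
  to : ∀ {y} → y ∈ map f xs → y ∈ ys
  to y∈ with ∈-map⁻ f y∈
  ... | _ , x∈ , refl = proj₁ (f-section x∈)
  from : ∀ {y} → y ∈ ys → y ∈ map f xs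
  from y∈ = let gy∈ , fgy≡y = g-section y∈ in subst (_∈ map f xs) fgy≡y (∈-map⁺ f gy∈)

fromTo : ℕ → ℕ → List ℕ
fromTo a b = map (a +_) (upTo (suc b ∸ a))

ΣFromTo-fromTo : ∀ a b f → ΣFromTo a b f ≡ sum (map f (fromTo a b))
ΣFromTo-fromTo a b f = cong sum (map-∘ (upTo (suc b ∸ a)))

ΣFromTo-cong : ∀ a b {f g} → (∀ x → f x ≡ g x) → ΣFromTo a b f ≡ ΣFromTo a b g
ΣFromTo-cong a b f≗g = cong sum (map-cong (λ t → f≗g (a + t)) (upTo (suc b ∸ a)))

length-dependentProduct-fromTo : ∀ a b (ys : ℕ → List B) →
  length (dependentProduct (fromTo a b) ys) ≡ ΣFromTo a b (length ∘ ys)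
length-dependentProduct-fromTo a b ys = trans (length-dependentProduct (fromTo a b)) (sym (ΣFromTo-fromTo a b _))

∈-fromTo⁺ : ∀ {a b x} → a ≤ x → x ≤ b → x ∈ fromTo a b
∈-fromTo⁺ {a} {b} {x} a≤x x≤b =
  subst (_∈ fromTo a b) (m+[n∸m]≡n a≤x) (∈-map⁺ (a +_) (∈-upTo⁺ (∸-monoˡ-< (s≤s x≤b) a≤x)))

∈-fromTo⁻ : ∀ a b {x} → x ∈ fromTo a b → a ≤ x × x ≤ b
∈-fromTo⁻ a b x∈ with ∈-map⁻ (a +_) x∈
... | t , t∈ , refl =
  m≤m+n a t , s≤s⁻¹ (subst (_≤ suc b) (trans (+-comm (suc t) a) (+-suc a t)) (m≤o∸n⇒m+n≤o (suc t) a≤1+b t<))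
  where
  t< : t < suc b ∸ a
  t< = ∈-upTo⁻ t∈
  a≤1+b : a ≤ suc b
  a≤1+b = <⇒≤ (m∸n≢0⇒n<m (λ eq → n≮0 (subst (t <_) eq t<)))

fromTo-unique : ∀ a b → Unique (fromTo a b)
fromTo-unique a b = Unique.map⁺ (+-cancelˡ-≡ a _ _) (Unique.upTo⁺ _)

∈-words⁻ : ∀ n k {w} → w ∈ words n k → length w ≡ n × All (_< k) w
∈-words⁻ zero    k (here refl) = refl , []
∈-words⁻ (suc n) k w∈ with find (∈-concatMap⁻ (λ v → map (_∷ v) (upTo k)) {xs = words n k} w∈)
... | v , v∈ , w∈′ with ∈-map⁻ (_∷ v) w∈′
...   | x , x∈ , refl = let lv , v<k = ∈-words⁻ n k v∈ in cong suc lv , ∈-upTo⁻ x∈ ∷ v<k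

∈-words⁺ : ∀ k {w} → All (_< k) w → w ∈ words (length w) k
∈-words⁺ k []                 = here refl
∈-words⁺ k {x ∷ w} (x<k ∷ w<k) =
  ∈-concatMap⁺ (λ v → map (_∷ v) (upTo k)) (lose (∈-words⁺ k w<k) (∈-map⁺ (_∷ w) (∈-upTo⁺ x<k)))

words-unique : ∀ n k → Unique (words n k)
words-unique zero    k = [] ∷ []
words-unique (suc n) k = subst Unique (sym (concatMap-map-dependentProduct (flip _∷_) (words n k)))
  (Unique.map⁺ (λ eq → let x≡ , v≡ = ∷-injective eq in cong₂ _,_ v≡ x≡)
                (dependentProduct⁺ (words-unique n k) (λ _ → Unique.upTo⁺ k)))

<+1⇔≤ : ∀ {x t} → x < t + 1 ⇔ x ≤ t
<+1⇔≤ {x} {t} =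
  mk⇔ (λ x<t+1 → s≤s⁻¹ (subst (x <_) (+-comm t 1) x<t+1)) (λ x≤t → subst (x <_) (+-comm 1 t) (s≤s x≤t))

<⇔≤∸1 : ∀ {j m} → 0 < m → j < m ⇔ j ≤ m ∸ 1
<⇔≤∸1 {m = suc m} _ = mk⇔ s≤s⁻¹ s≤s

+1≤⇔< : ∀ {m p} → m + 1 ≤ p ⇔ m < p
+1≤⇔< {m} {p} = mk⇔ (subst (_≤ p) (+-comm m 1)) (subst (_≤ p) (+-comm 1 m))

suc[m∸1]≡m : ∀ {m} → 0 < m → suc (m ∸ 1) ≡ m
suc[m∸1]≡m {suc m} _ = refl

[p∸1]+suc[n∸p]≡n : ∀ {p n} → 0 < p → p ≤ n → (p ∸ 1) + suc (n ∸ p) ≡ n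
[p∸1]+suc[n∸p]≡n {suc p} {suc n} _ (s≤s p≤n) = trans (+-suc p (n ∸ p)) (cong suc (m+[n∸m]≡n p≤n))

map-∸-+ : ∀ j b → map (_∸ j) (map (j +_) b) ≡ b
map-∸-+ j []      = refl
map-∸-+ j (x ∷ b) = cong₂ _∷_ (m+n∸m≡n j x) (map-∸-+ j b)

map-+-∸ : ∀ {j c} → All (j ≤_) c → map (j +_) (map (_∸ j) c) ≡ c
map-+-∸ []           = refl
map-+-∸ (j≤x ∷ c≥j) = cong₂ _∷_ (m+[n∸m]≡n j≤x) (map-+-∸ c≥j)

-- Maximum and first occurrence

maxEntry-upper : ∀ σ → All (_≤ maxEntry σ) σ
maxEntry-upper []      = []
maxEntry-upper (x ∷ σ) =
  m≤m⊔n x (maxEntry σ) ∷ All.map (λ y≤ → ≤-trans y≤ (m≤n⊔m x (maxEntry σ))) (maxEntry-upper σ)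

maxEntry-lub : ∀ {k σ} → All (_≤ k) σ → maxEntry σ ≤ k
maxEntry-lub []           = z≤n
maxEntry-lub (x≤k ∷ σ≤k) = ⊔-lub x≤k (maxEntry-lub σ≤k)

maxEntry-< : ∀ {k σ} → 0 < k → All (_< k) σ → maxEntry σ < k
maxEntry-< 0<k []           = 0<k
maxEntry-< 0<k (x<k ∷ σ<k) = ⊔-lub x<k (maxEntry-< 0<k σ<k)

maxEntry-∈ : ∀ σ → 0 < maxEntry σ → maxEntry σ ∈ σ
maxEntry-∈ (x ∷ σ) 0<max with ⊔-sel x (maxEntry σ)
... | inj₁ max≡x = here max≡x
... | inj₂ max≡y = there (subst (_∈ σ) (sym max≡y) (maxEntry-∈ σ (subst (0 <_) max≡y 0<max)))

splitAtFirst : ℕ → List ℕ → List ℕ × List ℕ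
splitAtFirst m []      = [] , []
splitAtFirst m (x ∷ σ) with x ≟ m
... | yes _ = [] , σ
... | no  _ = map₁ (x ∷_) (splitAtFirst m σ)

splitAtFirst-++ : ∀ {m} a c → All (_≢ m) a → splitAtFirst m (a ++ m ∷ c) ≡ (a , c)
splitAtFirst-++ {m} []      c []           with m ≟ m
... | yes _  = refl
... | no m≢m = contradiction refl m≢m
splitAtFirst-++ {m} (x ∷ a) c (x≢m ∷ a≢m) with x ≟ m
... | yes x≡m = contradiction x≡m x≢m
... | no _    = cong (map₁ (x ∷_)) (splitAtFirst-++ a c a≢m)

∈⇒splitAtFirst : ∀ {m σ} → m ∈ σ → ∃₂ λ a c → σ ≡ a ++ m ∷ c × All (_≢ m) a
∈⇒splitAtFirst {m} {x ∷ σ} m∈ with x ≟ m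
... | yes refl = [] , σ , refl , []
∈⇒splitAtFirst {m} {x ∷ σ} (here m≡x) | no x≢m = contradiction (sym m≡x) x≢m
∈⇒splitAtFirst {m} {x ∷ σ} (there m∈) | no x≢m with ∈⇒splitAtFirst m∈
... | a , c , refl , a≢m = x ∷ a , c , refl , x≢m ∷ a≢m

-- Inversion sequences, patterns, and the decomposition

-- The entry at 0-based position i is at most s + i; IsInvSeq is the case s = 0.
data InvSeqFrom : ℕ → List ℕ → Set where
  []  : ∀ {s} → InvSeqFrom s []
  _∷_ : ∀ {s x σ} → x ≤ s → InvSeqFrom (suc s) σ → InvSeqFrom s (x ∷ σ)

InvSeqFrom-lookup⁺ : ∀ s σ → (∀ i → lookup σ i ≤ s + toℕ i) → InvSeqFrom s σ
InvSeqFrom-lookup⁺ s []      h = []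
InvSeqFrom-lookup⁺ s (x ∷ σ) h =
  subst (x ≤_) (+-identityʳ s) (h fzero)
  ∷ InvSeqFrom-lookup⁺ (suc s) σ (λ i → subst (lookup σ i ≤_) (+-suc s (toℕ i)) (h (fsuc i)))

InvSeqFrom-lookup⁻ : ∀ {s σ} → InvSeqFrom s σ → ∀ i → lookup σ i ≤ s + toℕ i
InvSeqFrom-lookup⁻ {s} {x ∷ _} (x≤s ∷ _)   fzero    = subst (x ≤_) (sym (+-identityʳ s)) x≤s
InvSeqFrom-lookup⁻ {s} {_ ∷ σ} (_   ∷ inv) (fsuc i) =
  subst (lookup σ i ≤_) (sym (+-suc s (toℕ i))) (InvSeqFrom-lookup⁻ inv i)

IsInvSeq⇔InvSeqFrom0 : ∀ {σ} → IsInvSeq σ ⇔ InvSeqFrom 0 σ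
IsInvSeq⇔InvSeqFrom0 {σ} =
  mk⇔ (λ inv → InvSeqFrom-lookup⁺ 0 σ (s≤s⁻¹ ∘ inv)) (λ inv → s≤s ∘ InvSeqFrom-lookup⁻ inv)

InvSeqFrom-++⁻ : ∀ {s} a {c} → InvSeqFrom s (a ++ c) → InvSeqFrom s a × InvSeqFrom (s + length a) c
InvSeqFrom-++⁻ {s} []      {c} inv       = [] , subst (λ t → InvSeqFrom t c) (sym (+-identityʳ s)) inv
InvSeqFrom-++⁻ {s} (x ∷ a) {c} (x≤ ∷ inv) =
  let inv-a , inv-c = InvSeqFrom-++⁻ a inv
  in  x≤ ∷ inv-a , subst (λ t → InvSeqFrom t c) (sym (+-suc s (length a))) inv-c

InvSeqFrom-++⁺ : ∀ {s a c} → InvSeqFrom s a → InvSeqFrom (s + length a) c → InvSeqFrom s (a ++ c)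
InvSeqFrom-++⁺ {s} {c = c} []           inv-c = subst (λ t → InvSeqFrom t c) (+-identityʳ s) inv-c
InvSeqFrom-++⁺ {s} {x ∷ a} {c} (x≤ ∷ inv-a) inv-c =
  x≤ ∷ InvSeqFrom-++⁺ inv-a (subst (λ t → InvSeqFrom t c) (+-suc s (length a)) inv-c)

InvSeqFrom-bounded : ∀ {s σ} → All (_≤ s) σ → InvSeqFrom s σ
InvSeqFrom-bounded []           = []
InvSeqFrom-bounded (x≤s ∷ σ≤s) = x≤s ∷ InvSeqFrom-bounded (All.map m≤n⇒m≤1+n σ≤s)

InvSeqFrom⇒All< : ∀ {s σ} → InvSeqFrom s σ → All (_< s + length σ) σ
InvSeqFrom⇒All< {s} {σ} inv =
  All-lookup⁺ σ (λ i → ≤-<-trans (InvSeqFrom-lookup⁻ inv i) (+-monoʳ-< s (Fin.toℕ<n i)))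

Pattern100 Pattern120 : ℕ → ℕ → ℕ → Set
Pattern100 x y z = y < x × y ≡ z
Pattern120 x y z = z < x × x < y

-- Contains100 and Contains120 are Occurs Pattern100 and Occurs Pattern120 by definition.
Occurs : (ℕ → ℕ → ℕ → Set) → List ℕ → Set
Occurs P σ = Σ (Fin (length σ)) λ i → Σ (Fin (length σ)) λ j → Σ (Fin (length σ)) λ k →
  (i Fin.< j) × (j Fin.< k) × P (lookup σ i) (lookup σ j) (lookup σ k)

Avoids : (ℕ → ℕ → ℕ → Set) → List ℕ → Set
Avoids P = AllTriples (λ x y z → ¬ P x y z)

¬Occurs⇔Avoids : ∀ {P σ} → (¬ Occurs P σ) ⇔ Avoids P σ
¬Occurs⇔Avoids {P} {σ} = mk⇔
  (λ ¬occ → AllTriples-lookup⁺ σ (λ i<j j<k p → ¬occ (_ , _ , _ , i<j , j<k , p)))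
  (λ av → λ { (_ , _ , _ , i<j , j<k , p) → AllTriples-lookup⁻ av i<j j<k p })

Repeat : ℕ → ℕ → ℕ → Set
Repeat t x y = x ≡ y × x ≢ t

NoRepeatExcept : ℕ → List ℕ → Set
NoRepeatExcept t = AllPairs (λ x y → ¬ Repeat t x y)

NoRepeatExceptLast⇔ : ∀ {k ω} → NoRepeatExceptLast k ω ⇔ NoRepeatExcept (k ∸ 1) ω
NoRepeatExceptLast⇔ {k} {ω} = mk⇔
  (λ nr → AllPairs-lookup⁺ ω (λ i<j (x≡y , x≢t) → Fin.<-irrefl (nr _ _ x≡y x≢t) i<j))
  (λ nr i j x≡y x≢t → case Fin.<-cmp i j of λ where
    (tri< i<j _ _) → contradiction (x≡y , x≢t) (AllPairs-lookup⁻ nr i<j)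
    (tri≈ _ i≡j _) → i≡j
    (tri> _ _ j<i) → contradiction (sym x≡y , x≢t ∘ trans x≡y) (AllPairs-lookup⁻ nr j<i))

IsA-bounded : ∀ {m σ} → IsA m σ → All (_≤ m) σ
IsA-bounded {σ = σ} (_ , _ , _ , max≡m) = subst (λ k → All (_≤ k) σ) max≡m (maxEntry-upper σ)

-- The suffix after the first maximum; Tail (m ∸ j) is the condition defining 𝔟 with k = m ∸ j + 1.
Tail : ℕ → List ℕ → Set
Tail t c = All (_≤ t) c × Avoids Pattern120 c × NoRepeatExcept t c

Tail-shift : ∀ {j m} b → j ≤ m → Tail m (map (j +_) b) ⇔ Tail (m ∸ j) b
Tail-shift {j} {m} b j≤m = mk⇔
  (λ (c≤m , c-120 , c-rep) →
      All.map (λ {x} j+x≤m → m+n≤o⇒m≤o∸n x (subst (_≤ m) (+-comm j x) j+x≤m)) (All.map⁻ c≤m)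
    , AllTriples-map (λ ¬p (z<x , x<y) → ¬p (+-monoʳ-< j z<x , +-monoʳ-< j x<y)) (AllTriples-map⁻ b c-120)
    , AllPairs.map (λ {x} ¬r (x≡y , x≢t) →
                     ¬r (cong (j +_) x≡y , λ j+x≡m → x≢t (trans (sym (m+n∸m≡n j x)) (cong (_∸ j) j+x≡m))))
                   (AllPairs.map⁻ c-rep))
  (λ (b≤t , b-120 , b-rep) →
      All.map⁺ (All.map (λ {x} x≤t → subst (j + x ≤_) j+[m∸j]≡m (+-monoʳ-≤ j x≤t)) b≤t)
    , AllTriples-map⁺ (AllTriples-map (λ ¬p (z<x , x<y) → ¬p (+-cancelˡ-< j _ _ z<x , +-cancelˡ-< j _ _ x<y)) b-120)
    , AllPairs.map⁺ (AllPairs.map (λ {x} ¬r (x≡y , x≢m) →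
                                     ¬r (+-cancelˡ-≡ j _ _ x≡y , λ x≡t → x≢m (trans (cong (j +_) x≡t) j+[m∸j]≡m)))
                                  b-rep))
  where
  j+[m∸j]≡m : j + (m ∸ j) ≡ m
  j+[m∸j]≡m = m+[n∸m]≡n j≤m

Tail⇔IsB : ∀ {t b} → Tail t b ⇔ (All (_< t + 1) b × IsB (t + 1) b)
Tail⇔IsB {t} {b} = mk⇔
  (λ (b≤t , b-120 , b-rep) →
      All.map (Equivalence.from <+1⇔≤) b≤t
    , Equivalence.from ¬Occurs⇔Avoids b-120
    , Equivalence.from (NoRepeatExceptLast⇔ {t + 1}) (subst (λ s → NoRepeatExcept s b) (sym t+1∸1≡t) b-rep))
  (λ (b<t+1 , b-120 , b-rep) →
      All.map (Equivalence.to <+1⇔≤) b<t+1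
    , Equivalence.to ¬Occurs⇔Avoids b-120
    , subst (λ s → NoRepeatExcept s b) t+1∸1≡t (Equivalence.to (NoRepeatExceptLast⇔ {t + 1}) b-rep))
  where
  t+1∸1≡t : t + 1 ∸ 1 ≡ t
  t+1∸1≡t = m+n∸n≡m t 1

module _ {m : ℕ} where

  IsA-split⁺ : ∀ {j} a c → j < m → m ≤ length a → IsA j a → All (j ≤_) c → Tail m c → IsA m (a ++ m ∷ c)
  IsA-split⁺ {j} a c j<m m≤|a| a-isA@(a-inv , a-100 , a-120 , _) c≥j (c≤m , c-120 , c-rep) =
      Equivalence.from IsInvSeq⇔InvSeqFrom0
        (InvSeqFrom-++⁺ {a = a} (Equivalence.to IsInvSeq⇔InvSeqFrom0 a-inv)
                        (m≤|a| ∷ InvSeqFrom-bounded (All.map (λ z≤m → m≤n⇒m≤1+n (≤-trans z≤m m≤|a|)) c≤m)))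
    , Equivalence.from ¬Occurs⇔Avoids
        (separated {Pattern100} (λ (y<x , y≡z) → subst (_< _) y≡z y<x) (Equivalence.to ¬Occurs⇔Avoids a-100)
          (AllPairs.map (λ ¬r (y<m , y≡z) → ¬r (y≡z , <⇒≢ y<m)) c-rep
           ∷ AllTriples-fromAllPairs (λ x≤m ¬r (y<x , y≡z) → ¬r (y≡z , <⇒≢ (<-≤-trans y<x x≤m))) c≤m c-rep))
    , Equivalence.from ¬Occurs⇔Avoids
        (separated {Pattern120} proj₁ (Equivalence.to ¬Occurs⇔Avoids a-120)
          (AllPairs-fromAll (λ y≤m _ (_ , m<y) → <⇒≱ m<y y≤m) c≤m ∷ c-120))
    , ≤-antisym (maxEntry-lub σ≤m) (All.lookup (maxEntry-upper (a ++ m ∷ c)) (∈-++⁺ʳ a (here refl)))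
    where
    a≤j : All (_≤ j) a
    a≤j = IsA-bounded a-isA
    σ≤m : All (_≤ m) (a ++ m ∷ c)
    σ≤m = All.++⁺ (All.map (λ x≤j → ≤-trans x≤j (<⇒≤ j<m)) a≤j) (≤-refl ∷ c≤m)
    -- Both patterns end below their first letter, and a ≤ j ≤ m ∷ c.
    separated : ∀ {P} → (∀ {x y z} → P x y z → z < x) → Avoids P a → Avoids P (m ∷ c) → Avoids P (a ++ m ∷ c)
    separated P⇒z<x =
      AllTriples-++⁺-separated (λ x≤j j≤z p → <⇒≱ (P⇒z<x p) (≤-trans x≤j j≤z)) a≤j (<⇒≤ j<m ∷ c≥j)

  IsA-split⁻ : ∀ a c → 0 < m → All (_≢ m) a → IsA m (a ++ m ∷ c) →
    m ≤ length a × maxEntry a < m × IsA (maxEntry a) a × All (maxEntry a ≤_) c × Tail m c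
  IsA-split⁻ a c 0<m a≢m σ-isA@(σ-inv , σ-100 , σ-120 , _)
    with InvSeqFrom-++⁻ a (Equivalence.to IsInvSeq⇔InvSeqFrom0 σ-inv)
       | AllTriples-++⁻ a (Equivalence.to ¬Occurs⇔Avoids σ-100)
       | AllTriples-++⁻ a (Equivalence.to ¬Occurs⇔Avoids σ-120)
  ... | a-inv , m≤|a| ∷ _ | a-100 , _ , mc-100 ∷ _ | a-120 , cross-120 , _ ∷ c-120 =
      m≤|a| , j<m
    , ( Equivalence.from IsInvSeq⇔InvSeqFrom0 a-inv
      , Equivalence.from ¬Occurs⇔Avoids a-100
      , Equivalence.from ¬Occurs⇔Avoids a-120
      , refl )
    , c≥j
    , c≤m , c-120 , c-rep
    where
    j : ℕ
    j = maxEntry a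
    σ≤m : All (_≤ m) (a ++ m ∷ c)
    σ≤m = IsA-bounded σ-isA
    c≤m : All (_≤ m) c
    c≤m = All.tail (All.++⁻ʳ a σ≤m)
    j<m : j < m
    j<m = maxEntry-< 0<m (All.zipWith (uncurry ≤∧≢⇒<) (All.++⁻ˡ a σ≤m , a≢m))
    c-rep : NoRepeatExcept m c
    c-rep = AllPairs.zipWith (λ (y≤m , ¬p) (y≡z , y≢m) → ¬p (≤∧≢⇒< y≤m y≢m , y≡z))
                             (AllPairs-fromAll (λ y≤m _ → y≤m) c≤m , mc-100)
    -- A letter z < j after m would give the occurrence j m z of 120.
    c≥j : All (j ≤_) c
    c≥j = All.tabulate λ {z} z∈c → ≮⇒≥ λ z<j →
      All.lookup (AllPairs.head (All.lookup cross-120 (maxEntry-∈ a (≤-<-trans z≤n z<j)))) z∈c (z<j , j<m)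

-- Counting

module Decomposition (n m : ℕ) (0<m : 0 < m) (m<n : m < n) where

  prefixes : ℕ → ℕ → List (List ℕ)
  prefixes p j = filter (isA? j) (words (p ∸ 1) (p ∸ 1))

  tails : ℕ → ℕ → List (List ℕ)
  tails p j = filter (isB? (m ∸ j + 1)) (words (n ∸ p) (m ∸ j + 1))

  Piece : Set
  Piece = ℕ × ℕ × List ℕ × List ℕ

  subblock : ℕ → ℕ → List (List ℕ × List ℕ)
  subblock p j = dependentProduct (prefixes p j) (λ _ → tails p j)

  block : ℕ → List (ℕ × List ℕ × List ℕ)
  block p = dependentProduct (fromTo 0 (m ∸ 1)) (subblock p)

  pieces : List Piece
  pieces = dependentProduct (fromTo (m + 1) n) block

  glue : Piece → List ℕ
  glue (_ , j , a , b) = a ++ m ∷ map (j +_) b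

  cutAt : List ℕ × List ℕ → Piece
  cutAt (a , c) = suc (length a) , maxEntry a , a , map (_∸ maxEntry a) c

  cut : List ℕ → Piece
  cut σ = cutAt (splitAtFirst m σ)

  sequences : List (List ℕ)
  sequences = filter (isA? m) (words n n)

  length-pieces :
    length pieces ≡ ΣFromTo (m + 1) n (λ p → ΣFromTo 0 (m ∸ 1) (λ j → 𝔞 (p ∸ 1) j * 𝔟 (n ∸ p) (m ∸ j + 1)))
  length-pieces =
    trans (length-dependentProduct-fromTo (m + 1) n block) (ΣFromTo-cong (m + 1) n λ p →
    trans (length-dependentProduct-fromTo 0 (m ∸ 1) (subblock p)) (ΣFromTo-cong 0 (m ∸ 1) λ j →
    trans (length-dependentProduct (prefixes p j)) (sum-map-const (prefixes p j) _)))

  sequences-unique : Unique sequences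
  sequences-unique = Unique.filter⁺ (isA? m) (words-unique n n)

  pieces-unique : Unique pieces
  pieces-unique = dependentProduct⁺ (fromTo-unique (m + 1) n) λ p → dependentProduct⁺ (fromTo-unique 0 (m ∸ 1)) λ j →
    dependentProduct⁺ (Unique.filter⁺ (isA? j) (words-unique (p ∸ 1) (p ∸ 1))) λ _ →
    Unique.filter⁺ (isB? (m ∸ j + 1)) (words-unique (n ∸ p) (m ∸ j + 1))

  ∈-prefixes⁻ : ∀ p j {a} → a ∈ prefixes p j → length a ≡ p ∸ 1 × IsA j a
  ∈-prefixes⁻ p j a∈ =
    let a∈words , a-isA = ∈-filter⁻ (isA? j) a∈ in proj₁ (∈-words⁻ (p ∸ 1) (p ∸ 1) a∈words) , a-isA

  ∈-prefixes⁺ : ∀ {j a} → IsA j a → a ∈ prefixes (suc (length a)) j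
  ∈-prefixes⁺ {j} {a} a-isA@(a-inv , _) =
    ∈-filter⁺ (isA? j) (∈-words⁺ (length a) (InvSeqFrom⇒All< (Equivalence.to IsInvSeq⇔InvSeqFrom0 a-inv))) a-isA

  ∈-tails⁻ : ∀ p j {b} → b ∈ tails p j → length b ≡ n ∸ p × Tail (m ∸ j) b
  ∈-tails⁻ p j b∈ =
    let b∈words , isB = ∈-filter⁻ (isB? (m ∸ j + 1)) b∈
        |b|≡ , b< = ∈-words⁻ (n ∸ p) (m ∸ j + 1) b∈words
    in  |b|≡ , Equivalence.from Tail⇔IsB (b< , isB)

  ∈-tails⁺ : ∀ p j {b} → length b ≡ n ∸ p → Tail (m ∸ j) b → b ∈ tails p j
  ∈-tails⁺ p j {b} |b|≡ tail =
    let b< , isB = Equivalence.to Tail⇔IsB tail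
    in  ∈-filter⁺ (isB? (m ∸ j + 1)) (subst (λ l → b ∈ words l (m ∸ j + 1)) |b|≡ (∈-words⁺ (m ∸ j + 1) b<))
                  isB

  ∈-pieces⁻ : ∀ {p j a b} → (p , j , a , b) ∈ pieces →
    (m + 1 ≤ p × p ≤ n) × j ≤ m ∸ 1 × a ∈ prefixes p j × b ∈ tails p j
  ∈-pieces⁻ {p} {j} t∈ =
    let p∈ , pj∈ = ∈-dependentProduct⁻ (fromTo (m + 1) n) t∈
        j∈ , jab∈ = ∈-dependentProduct⁻ (fromTo 0 (m ∸ 1)) pj∈
    in  ∈-fromTo⁻ (m + 1) n p∈ , proj₂ (∈-fromTo⁻ 0 (m ∸ 1) j∈) , ∈-dependentProduct⁻ (prefixes p j) jab∈

  ∈-pieces⁺ : ∀ {p j a b} → m + 1 ≤ p → p ≤ n → j ≤ m ∸ 1 → a ∈ prefixes p j → b ∈ tails p j →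
              (p , j , a , b) ∈ pieces
  ∈-pieces⁺ m+1≤p p≤n j≤m-1 a∈ b∈ =
    ∈-dependentProduct⁺ (∈-fromTo⁺ m+1≤p p≤n)
      (∈-dependentProduct⁺ (∈-fromTo⁺ z≤n j≤m-1) (∈-dependentProduct⁺ a∈ b∈))

  cut-++ : ∀ {a c} → All (_≢ m) a → cut (a ++ m ∷ c) ≡ cutAt (a , c)
  cut-++ {a} {c} a≢m = cong cutAt (splitAtFirst-++ a c a≢m)

  glue-section : ∀ {t} → t ∈ pieces → glue t ∈ sequences × cut (glue t) ≡ t
  glue-section {p , j , a , b} t∈ with ∈-pieces⁻ t∈
  ... | (m+1≤p , p≤n) , j≤m-1 , a∈ , b∈ = ∈-filter⁺ (isA? m) σ∈words σ-isA , cut-glue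
    where
    σ : List ℕ
    σ = a ++ m ∷ map (j +_) b
    0<p : 0 < p
    0<p = <-≤-trans 0<m (<⇒≤ (Equivalence.to +1≤⇔< m+1≤p))
    |a|≡ : length a ≡ p ∸ 1
    |a|≡ = proj₁ (∈-prefixes⁻ p j a∈)
    a-isA : IsA j a
    a-isA = proj₂ (∈-prefixes⁻ p j a∈)
    |b|≡ : length b ≡ n ∸ p
    |b|≡ = proj₁ (∈-tails⁻ p j b∈)
    j<m : j < m
    j<m = Equivalence.from (<⇔≤∸1 0<m) j≤m-1
    m≤|a| : m ≤ length a
    m≤|a| = subst (m ≤_) (sym |a|≡) (Equivalence.to (<⇔≤∸1 0<p) (Equivalence.to +1≤⇔< m+1≤p))
    σ-isA : IsA m σ
    σ-isA = IsA-split⁺ a (map (j +_) b) j<m m≤|a| a-isA (All.map⁺ (All.universal (m≤m+n j) b))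
                       (Equivalence.from (Tail-shift b (<⇒≤ j<m)) (proj₂ (∈-tails⁻ p j b∈)))
    |σ|≡n : length σ ≡ n
    |σ|≡n = begin
      length σ                                ≡⟨ length-++ a ⟩
      length a + suc (length (map (j +_) b))  ≡⟨ cong₂ (λ x y → x + suc y) |a|≡ |map[b]|≡ ⟩
      (p ∸ 1) + suc (n ∸ p)                   ≡⟨ [p∸1]+suc[n∸p]≡n 0<p p≤n ⟩
      n                                       ∎
      where
      open ≡-Reasoning
      |map[b]|≡ : length (map (j +_) b) ≡ n ∸ p
      |map[b]|≡ = trans (length-map (j +_) b) |b|≡
    σ∈words : σ ∈ words n n
    σ∈words = subst (λ l → σ ∈ words l n) |σ|≡n
                    (∈-words⁺ n (All.map (λ x≤m → ≤-<-trans x≤m m<n) (IsA-bounded σ-isA)))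
    a≢m : All (_≢ m) a
    a≢m = All.map (λ x≤j → <⇒≢ (≤-<-trans x≤j j<m)) (IsA-bounded a-isA)
    cut-glue : cut σ ≡ (p , j , a , b)
    cut-glue = begin
      cut σ
        ≡⟨ cut-++ a≢m ⟩
      (suc (length a) , maxEntry a , a , map (_∸ maxEntry a) (map (j +_) b))
        ≡⟨ cong₂ (λ q k → q , k , a , map (_∸ k) (map (j +_) b)) 1+|a|≡p max[a]≡j ⟩
      (p , j , a , map (_∸ j) (map (j +_) b))
        ≡⟨ cong (λ b′ → p , j , a , b′) (map-∸-+ j b) ⟩
      (p , j , a , b)
        ∎
      where
      open ≡-Reasoning
      1+|a|≡p : suc (length a) ≡ p
      1+|a|≡p = trans (cong suc |a|≡) (suc[m∸1]≡m 0<p)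
      max[a]≡j : maxEntry a ≡ j
      max[a]≡j = proj₂ (proj₂ (proj₂ a-isA))

  cut-section : ∀ {σ} → σ ∈ sequences → cut σ ∈ pieces × glue (cut σ) ≡ σ
  cut-section {σ} σ∈ with ∈-filter⁻ (isA? m) σ∈
  ... | σ∈words , σ-isA@(_ , _ , _ , max≡m)
      with ∈⇒splitAtFirst (subst (_∈ σ) max≡m (maxEntry-∈ σ (subst (0 <_) (sym max≡m) 0<m)))
  ... | a , c , refl , a≢m with IsA-split⁻ a c 0<m a≢m σ-isA
  ... | m≤|a| , j<m , a-isA , c≥j , c-tail =
      subst (_∈ pieces) (sym (cut-++ a≢m)) piece∈
    , trans (cong glue (cut-++ a≢m)) (cong (λ c′ → a ++ m ∷ c′) (map-+-∸ c≥j))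
    where
    j : ℕ
    j = maxEntry a
    b : List ℕ
    b = map (_∸ j) c
    |σ|≡n : length a + suc (length c) ≡ n
    |σ|≡n = trans (sym (length-++ a)) (proj₁ (∈-words⁻ n n σ∈words))
    |b|≡ : length b ≡ n ∸ suc (length a)
    |b|≡ = begin
      length b                                   ≡⟨ length-map (_∸ j) c ⟩
      length c                                   ≡⟨ m+n∸m≡n (length a) (length c) ⟨
      length a + length c ∸ length a             ≡⟨ cong (_∸ suc (length a)) (+-suc (length a) (length c)) ⟨
      length a + suc (length c) ∸ suc (length a) ≡⟨ cong (_∸ suc (length a)) |σ|≡n ⟩
      n ∸ suc (length a)                         ∎
      where open ≡-Reasoning
    b-tail : Tail (m ∸ j) b
    b-tail = Equivalence.to (Tail-shift b (<⇒≤ j<m)) (subst (Tail m) (sym (map-+-∸ c≥j)) c-tail)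
    piece∈ : (suc (length a) , j , a , b) ∈ pieces
    piece∈ = ∈-pieces⁺ (Equivalence.from +1≤⇔< (s≤s m≤|a|))
                       (subst (suc (length a) ≤_) |σ|≡n (m<m+n (length a) z<s))
                       (Equivalence.to (<⇔≤∸1 0<m) j<m)
                       (∈-prefixes⁺ a-isA) (∈-tails⁺ (suc (length a)) j |b|≡ b-tail)

theorem12 : ∀ (n m : ℕ) → 0 < m → m < n →
    𝔞 n m ≡ ΣFromTo (m + 1) n (λ p → ΣFromTo 0 (m ∸ 1) (λ j → 𝔞 (p ∸ 1) j * 𝔟 (n ∸ p) (m ∸ j + 1)))
theorem12 n m 0<m m<n = begin
  𝔞 n m          ≡⟨ length-≡-bijection cut glue sequences-unique pieces-unique cut-section glue-section ⟩
  length pieces  ≡⟨ length-pieces ⟩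
  ΣFromTo (m + 1) n (λ p → ΣFromTo 0 (m ∸ 1) (λ j → 𝔞 (p ∸ 1) j * 𝔟 (n ∸ p) (m ∸ j + 1)))  ∎
  where
  open Decomposition n m 0<m m<n
  open ≡-Reasoning
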